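{- Let $p=3$, $k=0$, $e\ge1$, and $n=3^{l_1}+3^{l_2}+3^{l_3}$ where $l_1,l_2,l_3$ are non-negative integers. Then $D_{n,0}(1,x)$ is not a permutation polynomial of $\mathbb{F}_{3^e}$.
   Context: For an odd prime $p$ and $0\le k\le p-1$: for $n\ge 1$, $D_{n,k}(1,x)=\sum_{i=0}^{\lfloor n/2\rfloor}\frac{n-ki}{n-i}\binom{n-i}{i}(-x)^i$, where the coefficient is the integer $\binom{n-i}{i}-(k-1)\binom{n-i-1}{i-1}$ (with $\binom{m}{ -1}=0$) viewed in $\mathbb{F}_p$; $D_{0,k}(1,x)=2-k$. Equivalently $D_{1,k}=1$ and $D_{n,k}=D_{n-1,k}-xD_{n-2,k}$ for $n\ge2$. A polynomial over $\mathbb{F}_q$ is a permutation polynomial of $\mathbb{F}_q$ if it induces a bijection of $\mathbb{F}_q$. -}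

module Defs where

open import Level using (Level; _⊔_)
open import Algebra.Bundles using (CommutativeRing)
open import Data.Nat using (ℕ; zero; suc)
open import Data.Fin using (Fin)
open import Data.Product using (Σ; ∃; _×_)
open import Relation.Nullary using (¬_)
open import Relation.Binary.PropositionalEquality using (_≡_)

record IsField {c ℓ : Level} (R : CommutativeRing c ℓ) : Set (c ⊔ ℓ) where
  open CommutativeRing R
  field
    1#≉0# : ¬ (1# ≈ 0#)
    inverse : ∀ x → ¬ (x ≈ 0#) → ∃ λ y → x * y ≈ 1#

HasOrder : {c ℓ : Level} → CommutativeRing c ℓ → ℕ → Set (c ⊔ ℓ)
HasOrder R q = Σ (Fin q → Carrier) λ enum →
    (∀ i j → enum i ≈ enum j → i ≡ j) × (∀ x → ∃ λ i → enum i ≈ x)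
  where open CommutativeRing R

IsPermutation : {c ℓ : Level} (R : CommutativeRing c ℓ) →
                (CommutativeRing.Carrier R → CommutativeRing.Carrier R) → Set (c ⊔ ℓ)
IsPermutation R f =
    (∀ x y → f x ≈ f y → x ≈ y) × (∀ z → ∃ λ x → f x ≈ z)
  where open CommutativeRing R

-- Evaluation at x of the Dickson-type polynomial D_{n,k}(1,x) over R:
-- D_{0,k} = 2 - k, D_{1,k} = 1, D_{n,k} = D_{n-1,k} - x D_{n-2,k}.
module _ {c ℓ : Level} (R : CommutativeRing c ℓ) where
  open CommutativeRing R

  natR : ℕ → Carrier
  natR zero = 0#
  natR (suc n) = 1# + natR n

  D : ℕ → ℕ → Carrier → Carrier
  D k zero x = natR 2 - natR k
  D k (suc zero) x = 1#
  D k (suc (suc n)) x = D k (suc n) x - x * D k n x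

module Submission where

-- Write n = 3^l₁ + 3^l₂ + 3^l₃ and let F be a field with 3^e
-- elements.  Then
--   (1) n is odd, being a sum of three odd numbers;
--   (2) D_{m,k}(1,0) = 1 for every m ≥ 1, directly from the recurrence;
--   (3) if 3 = 0 in F, then D_{m+1,0}(1,1) = -D_{m,0}(1,1), so D_{m,0}(1,1)
--       is 2-periodic in m and equals D_{1,0}(1,1) = 1 for odd m;
--   (4) a ring with q elements satisfies q·1 = 0 (summing all elements is
--       invariant under the translation x ↦ x + 1), and in a field a power
--       3^e is zero only if 3 is zero; hence 3 = 0 in F.
-- By (1)-(4), D_{n,0}(1,x) takes the value 1 at both x = 0 and x = 1, so it
-- is not injective on F, since 0 ≠ 1.  In the file, the contrapositive of
-- (4) is used: injectivity forces 3 ≠ 0, contradicting the counting fact.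

open import Defs
open import Level using (Level)
open import Algebra.Bundles using (CommutativeRing)
open import Data.Nat using (ℕ; zero; suc; _^_; _≥_; parity)
open import Relation.Nullary using (¬_)
import Data.Nat as ℕ
open import Data.Parity as ℙ using (1ℙ)
import Data.Parity.Properties as Parity
open import Data.Fin using (Fin)
import Data.Fin.Permutation as Permutation
open import Data.Product using (_,_; proj₁; proj₂)
open import Function using (_∘_)
open import Relation.Binary.PropositionalEquality as ≡ using (_≡_)
import Algebra.Properties.Ring as RingProperties
import Algebra.Properties.CommutativeMonoid.Sum as SumProperties

odd-^ : ∀ m l → parity m ≡ 1ℙ → parity (m ^ l) ≡ 1ℙ
odd-^ m zero     _     = ≡.refl
odd-^ m (suc l) m-odd = begin
  parity (m ℕ.* m ^ l)         ≡⟨ Parity.*-homo-* m (m ^ l) ⟩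
  parity m ℙ.* parity (m ^ l)  ≡⟨ ≡.cong₂ ℙ._*_ m-odd (odd-^ m l m-odd) ⟩
  1ℙ                           ∎
  where open ≡.≡-Reasoning

sum-of-three-powers-of-3-odd : ∀ l₁ l₂ l₃ → parity (3 ^ l₁ ℕ.+ 3 ^ l₂ ℕ.+ 3 ^ l₃) ≡ 1ℙ
sum-of-three-powers-of-3-odd l₁ l₂ l₃ = begin
  parity (3 ^ l₁ ℕ.+ 3 ^ l₂ ℕ.+ 3 ^ l₃)
    ≡⟨ Parity.+-homo-+ (3 ^ l₁ ℕ.+ 3 ^ l₂) (3 ^ l₃) ⟩
  parity (3 ^ l₁ ℕ.+ 3 ^ l₂) ℙ.+ parity (3 ^ l₃)
    ≡⟨ ≡.cong (ℙ._+ parity (3 ^ l₃)) (Parity.+-homo-+ (3 ^ l₁) (3 ^ l₂)) ⟩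
  parity (3 ^ l₁) ℙ.+ parity (3 ^ l₂) ℙ.+ parity (3 ^ l₃)
    ≡⟨ ≡.cong₂ (λ a b → a ℙ.+ b ℙ.+ parity (3 ^ l₃))
                (odd-^ 3 l₁ ≡.refl) (odd-^ 3 l₂ ≡.refl) ⟩
  1ℙ ℙ.+ 1ℙ ℙ.+ parity (3 ^ l₃)
    ≡⟨ ≡.cong (1ℙ ℙ.+ 1ℙ ℙ.+_) (odd-^ 3 l₃ ≡.refl) ⟩
  1ℙ ∎
  where open ≡.≡-Reasoning

module RingFacts {c ℓ : Level} (R : CommutativeRing c ℓ) where
  open CommutativeRing R
  open RingProperties ring
    using (-0#≈0#; -‿involutive; +-inverseʳ-unique; +-identityʳ-unique; //-rightDividesˡ; //-rightDividesʳ)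
  open import Relation.Binary.Reasoning.Setoid setoid

  natR-+ : ∀ m n → natR R (m ℕ.+ n) ≈ natR R m + natR R n
  natR-+ zero    n = sym (+-identityˡ _)
  natR-+ (suc m) n = trans (+-congˡ (natR-+ m n)) (sym (+-assoc _ _ _))

  natR-* : ∀ m n → natR R (m ℕ.* n) ≈ natR R m * natR R n
  natR-* zero    n = sym (zeroˡ _)
  natR-* (suc m) n = begin
    natR R (n ℕ.+ m ℕ.* n)                ≈⟨ natR-+ n (m ℕ.* n) ⟩
    natR R n + natR R (m ℕ.* n)           ≈⟨ +-cong (sym (*-identityˡ _)) (natR-* m n) ⟩
    1# * natR R n + natR R m * natR R n   ≈⟨ sym (distribʳ _ _ _) ⟩
    (1# + natR R m) * natR R n            ∎

  natR-suc-* : ∀ n y → natR R (suc n) * y ≈ y + natR R n * y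
  natR-suc-* n y = trans (distribʳ y 1# (natR R n)) (+-congʳ (*-identityˡ y))

  D-at-0 : ∀ k m → D R k (suc m) 0# ≈ 1#
  D-at-0 k zero    = refl
  D-at-0 k (suc m) = begin
    D R k (suc m) 0# - 0# * D R k m 0#  ≈⟨ +-cong (D-at-0 k m) (-‿cong (zeroˡ _)) ⟩
    1# - 0#                             ≈⟨ +-congˡ -0#≈0# ⟩
    1# + 0#                             ≈⟨ +-identityʳ 1# ⟩
    1#                                  ∎

  -- Counting lemma (step (4), first half): a ring with q elements has
  -- q·1 = 0.  The translation x ↦ x + 1 permutes the elements, so the sum Σ
  -- of all elements satisfies Σ = Σ + q·1.
  order-annihilates : ∀ q → HasOrder R q → natR R q ≈ 0#
  order-annihilates q (enum , enum-injective , enum-surjective) =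
    +-identityʳ-unique (∑ enum) (natR R q) (sym sum-invariant)
    where
    open SumProperties +-commutativeMonoid using (sum-permute; sum-cong-≋; ∑-distrib-+)
      renaming (sum to ∑)

    index : Carrier → Fin q
    index x = proj₁ (enum-surjective x)

    enum-index : ∀ x → enum (index x) ≈ x
    enum-index x = proj₂ (enum-surjective x)

    shift unshift : Fin q → Fin q
    shift i   = index (enum i + 1#)
    unshift i = index (enum i - 1#)

    shift-unshift : ∀ i → shift (unshift i) ≡ i
    shift-unshift i = enum-injective _ _
      (trans (enum-index _) (trans (+-congʳ (enum-index _)) (//-rightDividesˡ 1# (enum i))))

    unshift-shift : ∀ i → unshift (shift i) ≡ i
    unshift-shift i = enum-injective _ _
      (trans (enum-index _) (trans (+-congʳ (enum-index _)) (//-rightDividesʳ 1# (enum i))))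

    ∑-ones : ∀ n → ∑ {n} (λ _ → 1#) ≈ natR R n
    ∑-ones zero    = refl
    ∑-ones (suc n) = +-congˡ (∑-ones n)

    sum-invariant : ∑ enum ≈ ∑ enum + natR R q
    sum-invariant = begin
      ∑ enum                            ≈⟨ sum-permute enum (Permutation.permutation shift unshift shift-unshift unshift-shift) ⟩
      ∑ (enum ∘ shift)                  ≈⟨ sum-cong-≋ {q} (λ i → enum-index (enum i + 1#)) ⟩
      ∑ (λ i → enum i + 1#)             ≈⟨ ∑-distrib-+ enum (λ _ → 1#) ⟩
      ∑ enum + ∑ {q} (λ _ → 1#)         ≈⟨ +-congˡ (∑-ones q) ⟩
      ∑ enum + natR R q                 ∎

  module Characteristic3 (three≈0 : natR R 3 ≈ 0#) where

    double≈neg : ∀ y → y + y ≈ - y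
    double≈neg y = +-inverseʳ-unique y (y + y) (begin
      y + (y + y)                ≈⟨ +-congˡ (+-congˡ (sym one-y)) ⟩
      y + (y + natR R 1 * y)     ≈⟨ +-congˡ (sym (natR-suc-* 1 y)) ⟩
      y + natR R 2 * y           ≈⟨ sym (natR-suc-* 2 y) ⟩
      natR R 3 * y               ≈⟨ *-congʳ three≈0 ⟩
      0# * y                     ≈⟨ zeroˡ y ⟩
      0#                         ∎)
      where
      one-y : natR R 1 * y ≈ y
      one-y = trans (natR-suc-* 0 y) (trans (+-congˡ (zeroˡ y)) (+-identityʳ y))

    -- D_{m+1,0}(1,1) = -D_{m,0}(1,1): the base case is 1 = -2, and the
    -- recurrence gives D_{m+2} = D_{m+1} - D_m = D_{m+1} + D_{m+1} = -D_{m+1}.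
    D-at-1-alternates : ∀ m → D R 0 (suc m) 1# ≈ - D R 0 m 1#
    D-at-1-alternates zero = +-inverseʳ-unique (natR R 2 - 0#) 1# (begin
      (natR R 2 - 0#) + 1#       ≈⟨ +-congʳ (trans (+-congˡ -0#≈0#) (+-identityʳ _)) ⟩
      natR R 2 + 1#              ≈⟨ +-comm _ _ ⟩
      natR R 3                   ≈⟨ three≈0 ⟩
      0#                         ∎)
    D-at-1-alternates (suc m) = begin
      D R 0 (suc m) 1# - 1# * D R 0 m 1#   ≈⟨ +-congˡ (-‿cong (*-identityˡ _)) ⟩
      D R 0 (suc m) 1# - D R 0 m 1#        ≈⟨ +-congˡ (sym (D-at-1-alternates m)) ⟩
      D R 0 (suc m) 1# + D R 0 (suc m) 1#  ≈⟨ double≈neg _ ⟩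
      - D R 0 (suc m) 1#                   ∎

    D-at-1-odd : ∀ m → parity m ≡ 1ℙ → D R 0 m 1# ≈ 1#
    D-at-1-odd (suc zero)    _     = refl
    D-at-1-odd (suc (suc m)) m-odd = begin
      D R 0 (suc (suc m)) 1#     ≈⟨ D-at-1-alternates (suc m) ⟩
      - D R 0 (suc m) 1#         ≈⟨ -‿cong (D-at-1-alternates m) ⟩
      - - D R 0 m 1#             ≈⟨ -‿involutive _ ⟩
      D R 0 m 1#                 ≈⟨ D-at-1-odd m m-odd ⟩
      1#                         ∎

  module _ (isField : IsField R) where
    open IsField isField

    no-zero-divisors : ∀ a b → ¬ (a ≈ 0#) → a * b ≈ 0# → b ≈ 0#
    no-zero-divisors a b a≉0 ab≈0 with inverse a a≉0
    ... | a⁻¹ , aa⁻¹≈1 = begin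
      b                  ≈⟨ sym (*-identityˡ b) ⟩
      1# * b             ≈⟨ *-congʳ (sym aa⁻¹≈1) ⟩
      (a * a⁻¹) * b      ≈⟨ *-congʳ (*-comm a a⁻¹) ⟩
      (a⁻¹ * a) * b      ≈⟨ *-assoc _ _ _ ⟩
      a⁻¹ * (a * b)      ≈⟨ *-congˡ ab≈0 ⟩
      a⁻¹ * 0#           ≈⟨ zeroʳ a⁻¹ ⟩
      0#                 ∎

    natR-^-nonzero : ∀ a e → ¬ (natR R a ≈ 0#) → ¬ (natR R (a ^ e) ≈ 0#)
    natR-^-nonzero a zero    _   1≈0  = 1#≉0# (trans (sym (+-identityʳ 1#)) 1≈0)
    natR-^-nonzero a (suc e) a≉0 aᵉ⁺¹≈0 = natR-^-nonzero a e a≉0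
      (no-zero-divisors (natR R a) (natR R (a ^ e)) a≉0 (trans (sym (natR-* a (a ^ e))) aᵉ⁺¹≈0))

-- Natural-number addition is brought into scope only here, since inside
-- RingFacts the name _+_ denotes the ring addition.
open import Data.Nat using (_+_)

mainTheorem9 : {c ℓ : Level} (F : CommutativeRing c ℓ) → IsField F →
    (e : ℕ) → e ≥ 1 → HasOrder F (3 ^ e) →
    (l₁ l₂ l₃ : ℕ) →
    ¬ IsPermutation F (D F 0 (3 ^ l₁ + 3 ^ l₂ + 3 ^ l₃))
mainTheorem9 F isField e _ hasOrder l₁ l₂ l₃ (D-injective , _) =
  natR-^-nonzero isField 3 e three≉0 (order-annihilates (3 ^ e) hasOrder)
  where
  open CommutativeRing F using (_≈_; 0#; 1#; sym; trans)
  open RingFacts F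
  open IsField isField using (1#≉0#)

  n : ℕ
  n = 3 ^ l₁ + 3 ^ l₂ + 3 ^ l₃

  -- If 3 = 0 in F then D_{n,0} takes the value 1 at both 0 and 1.
  three≉0 : ¬ (natR F 3 ≈ 0#)
  three≉0 three≈0 = 1#≉0# (sym (D-injective 0# 1# (trans D₀≈1 (sym D₁≈1))))
    where
    n-odd : parity n ≡ 1ℙ
    n-odd = sum-of-three-powers-of-3-odd l₁ l₂ l₃

    D₀≈1 : D F 0 n 0# ≈ 1#
    D₀≈1 = D-at-0-odd n n-odd
      where
      D-at-0-odd : ∀ m → parity m ≡ 1ℙ → D F 0 m 0# ≈ 1#
      D-at-0-odd (suc m) _ = D-at-0 0 m

    D₁≈1 : D F 0 n 1# ≈ 1#
    D₁≈1 = Characteristic3.D-at-1-odd three≈0 n n-odd
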